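{- A matrix $M\in\mathbb{Z}^{m\times n}$ is minimal if and only if for every $p\in\{1,\dots,m\}$, the $p\times n$ submatrix of $M$ consisting of its first $p$ rows is minimal (in $\mathbb{Z}^{p\times n}$).
   Context: Integer vectors are ordered lexicographically: $v<w$ iff there is $j$ with $v_i=w_i$ for all $i<j$ and $v_j<w_j$. The row-lex ordering $\le_R$ on $\mathbb{Z}^{p\times n}$ is the lexicographic extension of this ordering to matrices viewed as the sequence of their rows (first row most significant). Two matrices in $\mathbb{Z}^{p\times n}$ are Hadamard equivalent if one can be obtained from the other by a sequence of the operations: multiplying a row or a column by $-1$; swapping two rows or two columns. A matrix is minimal if it equals the $\le_R$-minimum of its Hadamard equivalence class. -}

module Defs where

open import Data.Nat using (ℕ; _≤_)
open import Data.Integer as ℤ using (ℤ; -_)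
open import Data.Fin as Fin using (Fin; _≟_; inject≤)
open import Data.Vec using (Vec; map; lookup; tabulate; _[_]%=_)
open import Data.Vec.Relation.Binary.Lex.Strict using (Lex-<; Lex-≤)
open import Relation.Binary.PropositionalEquality using (_≡_)
open import Relation.Binary.Construct.Closure.ReflexiveTransitive using (Star)
open import Relation.Nullary using (yes; no)

Mat : ℕ → ℕ → Set
Mat p n = Vec (Vec ℤ n) p

_<V_ : ∀ {n} → Vec ℤ n → Vec ℤ n → Set
_<V_ = Lex-< _≡_ ℤ._<_

_≤R_ : ∀ {p n} → Mat p n → Mat p n → Set
_≤R_ = Lex-≤ _≡_ _<V_

swapFin : ∀ {k} → Fin k → Fin k → Fin k → Fin k
swapFin i j x with x ≟ i
... | yes _ = j
... | no _ with x ≟ j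
...   | yes _ = i
...   | no _  = x

swapEntries : ∀ {k} {A : Set} → Fin k → Fin k → Vec A k → Vec A k
swapEntries i j v = tabulate (λ x → lookup v (swapFin i j x))

data HStep {p n : ℕ} : Mat p n → Mat p n → Set where
  negRow  : ∀ M (i : Fin p) → HStep M (M [ i ]%= map -_)
  negCol  : ∀ M (j : Fin n) → HStep M (map (λ r → r [ j ]%= -_) M)
  swapRow : ∀ M (i i' : Fin p) → HStep M (swapEntries i i' M)
  swapCol : ∀ M (j j' : Fin n) → HStep M (map (swapEntries j j') M)

-- Hadamard equivalence: obtainable by a finite sequence of operations
-- (each operation is an involution, so this relation is symmetric)
HadEquiv : ∀ {p n} → Mat p n → Mat p n → Set
HadEquiv = Star HStep

Minimal : ∀ {p n} → Mat p n → Set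
Minimal {p} {n} M = ∀ (N : Mat p n) → HadEquiv M N → M ≤R N

firstRows : ∀ {p m n} → p ≤ m → Mat m n → Mat p n
firstRows p≤m M = tabulate (λ i → lookup M (inject≤ i p≤m))

module Submission where

open import Defs
open import Data.Nat using (ℕ; _≤_; z≤n; s≤s)
open import Data.Nat.Properties using (≤-refl)
open import Data.Integer using (ℤ; -_)
open import Data.Fin using (Fin; _≟_; inject≤)
open import Data.Fin.Properties using (inject≤-injective; inject≤-refl)
open import Data.Vec using (Vec; []; _∷_; map; lookup; tabulate; _[_]%=_)
open import Data.Vec.Properties
  using (lookup∘tabulate; tabulate-cong; tabulate-∘; lookup-map; lookup∘updateAt; lookup∘updateAt′)
open import Data.Vec.Relation.Binary.Pointwise.Extensional using (ext; Pointwise-≡⇒≡)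
open import Data.Vec.Relation.Binary.Lex.Core using (base; this; next)
open import Data.Product using (Σ; _×_; _,_)
open import Data.Unit using (tt)
open import Function.Base using (_∘_)
open import Function.Bundles using (_⇔_; mk⇔)
open import Function.Definitions using (Injective)
open import Relation.Binary.PropositionalEquality
open import Relation.Binary.Construct.Closure.ReflexiveTransitive using (ε; _◅_)
open import Relation.Nullary using (yes; no; contradiction)

-- A Hadamard operation on the first p rows of M is the restriction of the same
-- operation on M (row indices embedded by inject≤), so every matrix equivalent
-- to a truncation of M is the truncation of a matrix equivalent to M. As
-- truncation preserves the row-lex order, minimality passes to every
-- truncation; the converse is the case p = m.

injective-swapFin : ∀ {p m} (f : Fin p → Fin m) → Injective _≡_ _≡_ f →
  ∀ i j x → f (swapFin i j x) ≡ swapFin (f i) (f j) (f x)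
injective-swapFin f f-inj i j x with x ≟ i | f x ≟ f i
... | yes _   | yes _     = refl
... | yes x≡i | no fx≢fi  = contradiction (cong f x≡i) fx≢fi
... | no x≢i  | yes fx≡fi = contradiction (f-inj fx≡fi) x≢i
... | no _    | no _ with x ≟ j | f x ≟ f j
...   | yes _   | yes _     = refl
...   | yes x≡j | no fx≢fj  = contradiction (cong f x≡j) fx≢fj
...   | no x≢j  | yes fx≡fj = contradiction (f-inj fx≡fj) x≢j
...   | no _    | no _      = refl

module _ {p m : ℕ} (p≤m : p ≤ m) where

  private
    ι : Fin p → Fin m
    ι i = inject≤ i p≤m

    ι-injective : Injective _≡_ _≡_ ι
    ι-injective = inject≤-injective p≤m p≤m _ _

  lookup-firstRows : ∀ {n} (M : Mat m n) i → lookup (firstRows p≤m M) i ≡ lookup M (ι i)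
  lookup-firstRows M = lookup∘tabulate _

  firstRows-map : ∀ {n} (f : Vec ℤ n → Vec ℤ n) (M : Mat m n) →
    firstRows p≤m (map f M) ≡ map f (firstRows p≤m M)
  firstRows-map f M =
    trans (tabulate-cong (λ x → lookup-map (ι x) f M)) (tabulate-∘ f (lookup M ∘ ι))

  firstRows-updateAt : ∀ {n} (f : Vec ℤ n → Vec ℤ n) (M : Mat m n) i →
    firstRows p≤m (M [ ι i ]%= f) ≡ firstRows p≤m M [ i ]%= f
  firstRows-updateAt f M i = Pointwise-≡⇒≡ (ext pointwise)
    where
    pointwise : ∀ x → lookup (firstRows p≤m (M [ ι i ]%= f)) x ≡ lookup (firstRows p≤m M [ i ]%= f) x
    pointwise x with x ≟ i
    ... | yes refl = begin
      lookup (firstRows p≤m (M [ ι x ]%= f)) x ≡⟨ lookup-firstRows (M [ _ ]%= f) x ⟩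
      lookup (M [ ι x ]%= f) (ι x)             ≡⟨ lookup∘updateAt (ι x) M ⟩
      f (lookup M (ι x))                      ≡⟨ cong f (lookup-firstRows M x) ⟨
      f (lookup (firstRows p≤m M) x)          ≡⟨ lookup∘updateAt x (firstRows p≤m M) ⟨
      lookup (firstRows p≤m M [ x ]%= f) x    ∎
      where open ≡-Reasoning
    ... | no x≢i = begin
      lookup (firstRows p≤m (M [ ι i ]%= f)) x ≡⟨ lookup-firstRows (M [ _ ]%= f) x ⟩
      lookup (M [ ι i ]%= f) (ι x)             ≡⟨ lookup∘updateAt′ (ι x) (ι i) (x≢i ∘ ι-injective) M ⟩
      lookup M (ι x)                           ≡⟨ lookup-firstRows M x ⟨
      lookup (firstRows p≤m M) x               ≡⟨ lookup∘updateAt′ x i x≢i (firstRows p≤m M) ⟨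
      lookup (firstRows p≤m M [ i ]%= f) x     ∎
      where open ≡-Reasoning

  firstRows-swapEntries : ∀ {n} (M : Mat m n) i j →
    firstRows p≤m (swapEntries (ι i) (ι j) M) ≡ swapEntries i j (firstRows p≤m M)
  firstRows-swapEntries M i j = tabulate-cong λ x → begin
    lookup (swapEntries (ι i) (ι j) M) (ι x)   ≡⟨ lookup∘tabulate _ (ι x) ⟩
    lookup M (swapFin (ι i) (ι j) (ι x))       ≡⟨ cong (lookup M) (injective-swapFin ι ι-injective i j x) ⟨
    lookup M (ι (swapFin i j x))               ≡⟨ lookup-firstRows M (swapFin i j x) ⟨
    lookup (firstRows p≤m M) (swapFin i j x)   ∎
    where open ≡-Reasoning

  HStep-lift-firstRows : ∀ {n} (M : Mat m n) {B} → HStep (firstRows p≤m M) B →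
    Σ (Mat m n) λ M′ → HStep M M′ × firstRows p≤m M′ ≡ B
  HStep-lift-firstRows M (negRow _ i) =
    _ , negRow M (ι i) , firstRows-updateAt (map -_) M i
  HStep-lift-firstRows M (negCol _ j) =
    _ , negCol M j , firstRows-map (λ r → r [ j ]%= -_) M
  HStep-lift-firstRows M (swapRow _ i i′) =
    _ , swapRow M (ι i) (ι i′) , firstRows-swapEntries M i i′
  HStep-lift-firstRows M (swapCol _ j j′) =
    _ , swapCol M j j′ , firstRows-map (swapEntries j j′) M

  HadEquiv-lift-firstRows : ∀ {n} (M : Mat m n) {B} → HadEquiv (firstRows p≤m M) B →
    Σ (Mat m n) λ M′ → HadEquiv M M′ × firstRows p≤m M′ ≡ B
  HadEquiv-lift-firstRows M ε = M , ε , refl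
  HadEquiv-lift-firstRows M (step ◅ steps) with HStep-lift-firstRows M step
  ... | M′ , step′ , refl with HadEquiv-lift-firstRows M′ steps
  ...   | M″ , steps′ , eq = M″ , step′ ◅ steps′ , eq

firstRows-mono-≤R : ∀ {p m n} (p≤m : p ≤ m) {M N : Mat m n} →
  M ≤R N → firstRows p≤m M ≤R firstRows p≤m N
firstRows-mono-≤R z≤n       _               = base tt
firstRows-mono-≤R (s≤s p≤m) (this row< _)   = this row< refl
firstRows-mono-≤R (s≤s p≤m) (next refl M≤N) = next refl (firstRows-mono-≤R p≤m M≤N)

firstRows-refl : ∀ {m n} (m≤m : m ≤ m) (M : Mat m n) → firstRows m≤m M ≡ M
firstRows-refl m≤m M = Pointwise-≡⇒≡ (ext λ x →
  trans (lookup-firstRows m≤m M x) (cong (lookup M) (inject≤-refl x m≤m)))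

minimal-firstRows : ∀ {p m n} (p≤m : p ≤ m) {M : Mat m n} →
  Minimal M → Minimal (firstRows p≤m M)
minimal-firstRows p≤m {M} M-min B M≈B with HadEquiv-lift-firstRows p≤m M M≈B
... | N , M≈N , refl = firstRows-mono-≤R p≤m (M-min N M≈N)

minimal-[] : ∀ {n} → Minimal {0} {n} []
minimal-[] [] _ = base tt

mainTheorem4 : ∀ {m n : ℕ} (M : Mat m n) →
    Minimal M ⇔ (∀ (p : ℕ) → 1 ≤ p → (p≤m : p ≤ m) → Minimal (firstRows p≤m M))
mainTheorem4 M = mk⇔ (λ M-min p _ p≤m → minimal-firstRows p≤m M-min) (fromTruncations M)
  where
  fromTruncations : ∀ {m n} (M : Mat m n) →
    (∀ (p : ℕ) → 1 ≤ p → (p≤m : p ≤ m) → Minimal (firstRows p≤m M)) → Minimal M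
  fromTruncations []        _       = minimal-[]
  fromTruncations M@(_ ∷ _) all-min =
    subst Minimal (firstRows-refl ≤-refl M) (all-min _ (s≤s z≤n) ≤-refl)
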